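{- For every $n \geq 1$ and every $u \in \mathsf{Tr}(n)$, $\mathrm{in}(u) + \mathrm{out}(u) = n$, where $\mathrm{in}(u)$ (resp. $\mathrm{out}(u)$) is the number of elements of $\mathsf{Tr}(n)$ covered by (resp. covering) $u$.
   Context: For $n\ge1$, $\mathsf{Tr}(n)$ is the set of words $u = u_1\cdots u_n$ over $\{0,1,2\}$ with $u_1 \neq 2$ and no indices $i<j$ with $u_i=0$, $u_j=1$, ordered componentwise ($u\preccurlyeq v$ iff $u_i\le v_i$ for all $i$). -}

module Defs where

open import Data.Nat using (ℕ; zero; suc)
open import Data.Fin using (Fin; zero; suc; toℕ) renaming (_<_ to _<ᶠ_; _≤_ to _≤ᶠ_; _≤?_ to _≤ᶠ?_; _<?_ to _<ᶠ?_)
open import Data.Fin.Properties using (all?) renaming (_≟_ to _≟ᶠ_)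
import Data.Nat.Properties as ℕP
open import Data.Vec using (Vec; []; _∷_; lookup)
open import Data.Vec.Properties using (≡-dec)
open import Data.List using (List; []; _∷_; _++_; map; filter; length)
open import Data.List.Membership.Propositional using (_∈_)
open import Data.List.Membership.Propositional.Properties using (∈-map⁺; ∈-++⁺ˡ; ∈-++⁺ʳ)
open import Data.List.Relation.Unary.All as All using (All)
open import Data.List.Relation.Unary.Any using (here)
open import Data.Product using (_×_; _,_)
open import Relation.Nullary using (¬_; Dec; yes; no; ¬?; _×-dec_; _→-dec_)
open import Relation.Binary.PropositionalEquality using (_≡_; _≢_; refl)

Word : ℕ → Set
Word n = Vec (Fin 3) n

-- Membership in Tr(n): first letter is not 2, and no i < j with u_i = 0, u_j = 1.
-- (Position i with toℕ i ≡ 0 is the first position u_1.)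
InTr : {n : ℕ} → Word n → Set
InTr {n} u =
  ((i : Fin n) → toℕ i ≡ 0 → toℕ (lookup u i) ≢ 2) ×
  ((i j : Fin n) → i <ᶠ j → toℕ (lookup u i) ≡ 0 → toℕ (lookup u j) ≢ 1)

_≼_ : {n : ℕ} → Word n → Word n → Set
_≼_ {n} u v = (i : Fin n) → lookup u i ≤ᶠ lookup v i

_≺_ : {n : ℕ} → Word n → Word n → Set
u ≺ v = (u ≼ v) × (u ≢ v)

_⋖_ : {n : ℕ} → Word n → Word n → Set
_⋖_ {n} u v = InTr u × InTr v × (u ≺ v) ×
  ((w : Word n) → InTr w → ¬ ((u ≺ w) × (w ≺ v)))

allWords : (n : ℕ) → List (Word n)
allWords zero = [] ∷ []
allWords (suc n) =
  map (zero ∷_) ws ++ (map (suc zero ∷_) ws ++ map (suc (suc zero) ∷_) ws)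
  where ws = allWords n

allWords-complete : {n : ℕ} (w : Word n) → w ∈ allWords n
allWords-complete [] = here refl
allWords-complete (zero ∷ w) = ∈-++⁺ˡ (∈-map⁺ _ (allWords-complete w))
allWords-complete {suc n} (suc zero ∷ w) =
  ∈-++⁺ʳ (map (zero ∷_) (allWords n)) (∈-++⁺ˡ (∈-map⁺ _ (allWords-complete w)))
allWords-complete {suc n} (suc (suc zero) ∷ w) =
  ∈-++⁺ʳ (map (zero ∷_) (allWords n))
    (∈-++⁺ʳ (map (suc zero ∷_) (allWords n)) (∈-map⁺ _ (allWords-complete w)))

InTr? : {n : ℕ} (u : Word n) → Dec (InTr u)
InTr? u =
  all? (λ i → (toℕ i ℕP.≟ 0) →-dec ¬? (toℕ (lookup u i) ℕP.≟ 2)) ×-dec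
  all? (λ i → all? (λ j → (i <ᶠ? j) →-dec ((toℕ (lookup u i) ℕP.≟ 0) →-dec ¬? (toℕ (lookup u j) ℕP.≟ 1))))

_≼?_ : {n : ℕ} (u v : Word n) → Dec (u ≼ v)
u ≼? v = all? (λ i → lookup u i ≤ᶠ? lookup v i)

_≺?_ : {n : ℕ} (u v : Word n) → Dec (u ≺ v)
u ≺? v = (u ≼? v) ×-dec ¬? (≡-dec _≟ᶠ_ u v)

private
  decAll : {n : ℕ} (P : Word n → Set) → ((w : Word n) → Dec (P w)) → Dec ((w : Word n) → P w)
  decAll {n} P P? with All.all? P? (allWords n)
  ... | yes a = yes (λ w → All.lookup a (allWords-complete w))
  ... | no ¬a = no (λ f → ¬a (All.tabulate (λ {w} _ → f w)))

_⋖?_ : {n : ℕ} (u v : Word n) → Dec (u ⋖ v)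
u ⋖? v = InTr? u ×-dec (InTr? v ×-dec ((u ≺? v) ×-dec
  decAll _ (λ w → InTr? w →-dec ¬? ((u ≺? w) ×-dec (w ≺? v)))))

inDeg : {n : ℕ} → Word n → ℕ
inDeg {n} u = length (filter (λ v → v ⋖? u) (allWords n))

outDeg : {n : ℕ} → Word n → ℕ
outDeg {n} u = length (filter (λ v → u ⋖? v) (allWords n))

module Submission where

-- Membership in Tr(n) is recognised by a three-phase automaton reading a
-- word from left to right: in phase `start` (first letter) the letter 2 is forbidden, in
-- phase `noZero` (no 0 read yet) every letter is allowed, and in phase `zeroSeen` the
-- letter 1 is forbidden.  Working with the language accepted from an arbitrary phase makes
-- everything structural in the first letter:
--   * a cover u ⋖ v of accepted words either keeps the first letter, and then the tails
--     form a cover from the next phase, or keeps the tail and raises the first letter by a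
--     "head step" (0→1, 1→2, or 0→2 when the intermediate word starting with 1 is rejected);
--   * hence the degree (lower plus upper covers) of a word a∷w is the degree of w from the
--     next phase plus the number of covers changing only the first letter.
-- Solving this recursion shows that the degree of an accepted word of length n is n from
-- the phases `start` and `zeroSeen`, and n + [the word contains a 1] from `noZero`.
-- The theorem is the case of phase `start`, after identifying Tr(n) with the language
-- accepted from `start`, the covering relation ⋖ with the recursive cover test, and the
-- lengths of the filtered lists with Boolean counts.

open import Defs
open import Data.Nat using (ℕ; _+_; _≥_; suc; z≤n; s≤s; z<s; s<s)
open import Data.Bool using (Bool; true; false; _∧_; not; if_then_else_; T)
open import Data.Bool.Properties using (T-∧)
open import Data.Fin using (Fin; toℕ) renaming (zero to fz; suc to fs; _≤_ to _≤ᶠ_; _<_ to _<ᶠ_)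
import Data.Fin.Properties as FinP
import Data.Nat.Properties as ℕP
open import Data.Nat.Tactic.RingSolver using (solve-∀)
open import Data.Vec using ([]; _∷_; lookup)
open import Data.Vec.Properties using (∷-injective; ≡-dec)
open import Data.List using (List; []; _∷_; _++_; map; filter; length)
open import Data.Product using (_×_; _,_; proj₁; proj₂)
open import Data.Empty using (⊥-elim)
open import Data.Unit using (tt)
open import Function.Base using (_$_)
open import Function.Bundles using (Equivalence; _⇔_; mk⇔)
open import Relation.Nullary using (¬_; Dec; yes; no; does)
open import Relation.Binary.PropositionalEquality using (_≡_; _≢_; refl; sym; trans; cong; cong₂; module ≡-Reasoning)

pattern f0 = fz
pattern f1 = fs fz
pattern f2 = fs (fs fz)

∧-elim : {x y : Bool} → T (x ∧ y) → T x × T y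
∧-elim = Equivalence.to T-∧

∧-intro : {x y : Bool} → T x → T y → T (x ∧ y)
∧-intro p q = Equivalence.from T-∧ (p , q)

data Phase : Set where
  start noZero zeroSeen : Phase

allowed : Phase → Fin 3 → Bool
allowed start    f2 = false
allowed zeroSeen f1 = false
allowed _        _  = true

next : Phase → Fin 3 → Phase
next zeroSeen _  = zeroSeen
next start    f0 = zeroSeen
next noZero   f0 = zeroSeen
next start    _  = noZero
next noZero   _  = noZero

accepts : {n : ℕ} → Phase → Word n → Bool
accepts s []      = true
accepts s (a ∷ w) = allowed s a ∧ accepts (next s a) w

Accepted : {n : ℕ} → Phase → Word n → Set
Accepted s w = T (accepts s w)

accepted-head : {n : ℕ} (s : Phase) (a : Fin 3) (w : Word n) → Accepted s (a ∷ w) → T (allowed s a)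
accepted-head s a w h = proj₁ (∧-elim {allowed s a} h)

accepted-tail : {n : ℕ} (s : Phase) (a : Fin 3) (w : Word n) → Accepted s (a ∷ w) → Accepted (next s a) w
accepted-tail s a w h = proj₂ (∧-elim {allowed s a} h)

zeroSeen⊆noZero : {n : ℕ} (w : Word n) → Accepted zeroSeen w → Accepted noZero w
zeroSeen⊆noZero []       _ = tt
zeroSeen⊆noZero (f0 ∷ w) h = h
zeroSeen⊆noZero (f2 ∷ w) h = zeroSeen⊆noZero w h

next-mono : {n : ℕ} (s : Phase) {a b : Fin 3} (w : Word n) → a ≤ᶠ b →
  Accepted (next s a) w → Accepted (next s b) w
next-mono zeroSeen         w _ h = h
next-mono start  {f0} {f0} w _ h = h
next-mono start  {f0} {f1} w _ h = zeroSeen⊆noZero w h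
next-mono start  {f0} {f2} w _ h = zeroSeen⊆noZero w h
next-mono start  {f1} {f1} w _ h = h
next-mono start  {f1} {f2} w _ h = h
next-mono start  {f2} {f1} w (s≤s ()) h
next-mono start  {f2} {f2} w _ h = h
next-mono noZero {f0} {f0} w _ h = h
next-mono noZero {f0} {f1} w _ h = zeroSeen⊆noZero w h
next-mono noZero {f0} {f2} w _ h = zeroSeen⊆noZero w h
next-mono noZero {f1} {f1} w _ h = h
next-mono noZero {f1} {f2} w _ h = h
next-mono noZero {f2} {f1} w (s≤s ()) h
next-mono noZero {f2} {f2} w _ h = h

NoOne : {n : ℕ} → Word n → Set
NoOne {n} w = (i : Fin n) → toℕ (lookup w i) ≢ 1

NoZeroBeforeOne : {n : ℕ} → Word n → Set
NoZeroBeforeOne {n} w = (i j : Fin n) → i <ᶠ j → toℕ (lookup w i) ≡ 0 → toℕ (lookup w j) ≢ 1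

zeroSeen-sound : {n : ℕ} (w : Word n) → Accepted zeroSeen w → NoOne w
zeroSeen-sound (f0 ∷ w) h fz ()
zeroSeen-sound (f2 ∷ w) h fz ()
zeroSeen-sound (f0 ∷ w) h (fs i) = zeroSeen-sound w h i
zeroSeen-sound (f2 ∷ w) h (fs i) = zeroSeen-sound w h i

zeroSeen-complete : {n : ℕ} (w : Word n) → NoOne w → Accepted zeroSeen w
zeroSeen-complete []       h = tt
zeroSeen-complete (f0 ∷ w) h = zeroSeen-complete w (λ i → h (fs i))
zeroSeen-complete (f1 ∷ w) h = h fz refl
zeroSeen-complete (f2 ∷ w) h = zeroSeen-complete w (λ i → h (fs i))

noZero-sound : {n : ℕ} (w : Word n) → Accepted noZero w → NoZeroBeforeOne w
noZero-sound (a ∷ w)  h fz     fz     () e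
noZero-sound (f0 ∷ w) h fz     (fs j) p  e = zeroSeen-sound w h j
noZero-sound (f0 ∷ w) h (fs i) (fs j) (s≤s p) e = noZero-sound w (zeroSeen⊆noZero w h) i j p e
noZero-sound (f1 ∷ w) h (fs i) (fs j) (s≤s p) e = noZero-sound w h i j p e
noZero-sound (f2 ∷ w) h (fs i) (fs j) (s≤s p) e = noZero-sound w h i j p e

noZero-complete : {n : ℕ} (w : Word n) → NoZeroBeforeOne w → Accepted noZero w
noZero-complete []       h = tt
noZero-complete (f0 ∷ w) h = zeroSeen-complete w (λ j → h fz (fs j) (s≤s z≤n) refl)
noZero-complete (f1 ∷ w) h = noZero-complete w (λ i j p → h (fs i) (fs j) (s≤s p))
noZero-complete (f2 ∷ w) h = noZero-complete w (λ i j p → h (fs i) (fs j) (s≤s p))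

-- From `start` the first letter must differ from 2; afterwards the phase is that of `noZero`.
start-sound : {n : ℕ} (u : Word n) → Accepted start u → InTr u
start-sound []       _ = (λ ()) , (λ ())
start-sound (f0 ∷ w) h = firstLetter , noZero-sound (f0 ∷ w) h
  where
  firstLetter : (i : Fin _) → toℕ i ≡ 0 → toℕ (lookup (f0 ∷ w) i) ≢ 2
  firstLetter fz _ ()
start-sound (f1 ∷ w) h = firstLetter , noZero-sound (f1 ∷ w) h
  where
  firstLetter : (i : Fin _) → toℕ i ≡ 0 → toℕ (lookup (f1 ∷ w) i) ≢ 2
  firstLetter fz _ ()
start-sound (f2 ∷ w) ()

start-complete : {n : ℕ} (u : Word n) → InTr u → Accepted start u
start-complete []       _                     = tt
start-complete (f0 ∷ w) (_ , noZeroBeforeOne) = noZero-complete (f0 ∷ w) noZeroBeforeOne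
start-complete (f1 ∷ w) (_ , noZeroBeforeOne) = noZero-complete (f1 ∷ w) noZeroBeforeOne
start-complete (f2 ∷ w) (firstLetter , _)     = firstLetter fz refl refl

≼-cons : {n : ℕ} {a b : Fin 3} {u v : Word n} → a ≤ᶠ b → u ≼ v → (a ∷ u) ≼ (b ∷ v)
≼-cons a≤b u≼v fz     = a≤b
≼-cons a≤b u≼v (fs i) = u≼v i

≼-head : {n : ℕ} {a b : Fin 3} {u v : Word n} → (a ∷ u) ≼ (b ∷ v) → a ≤ᶠ b
≼-head p = p fz

≼-tail : {n : ℕ} {a b : Fin 3} {u v : Word n} → (a ∷ u) ≼ (b ∷ v) → u ≼ v
≼-tail p i = p (fs i)

≼-refl : {n : ℕ} (u : Word n) → u ≼ u
≼-refl u i = FinP.≤-refl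

≼-antisym : {n : ℕ} (u v : Word n) → u ≼ v → v ≼ u → u ≡ v
≼-antisym []      []      p q = refl
≼-antisym (a ∷ u) (b ∷ v) p q =
  cong₂ _∷_ (FinP.≤-antisym (≼-head p) (≼-head q)) (≼-antisym u v (≼-tail p) (≼-tail q))

≺-cons : {n : ℕ} (a : Fin 3) {u v : Word n} → u ≺ v → (a ∷ u) ≺ (a ∷ v)
≺-cons a (u≼v , u≢v) = ≼-cons FinP.≤-refl u≼v , λ e → u≢v (proj₂ (∷-injective e))

≺-tail : {n : ℕ} {a : Fin 3} {u v : Word n} → (a ∷ u) ≺ (a ∷ v) → u ≺ v
≺-tail {a = a} (p , ne) = ≼-tail p , λ e → ne (cong (a ∷_) e)

≺-head : {n : ℕ} {a b : Fin 3} (w : Word n) → a <ᶠ b → (a ∷ w) ≺ (b ∷ w)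
≺-head w a<b = ≼-cons (ℕP.<⇒≤ a<b) (≼-refl w) , λ e → FinP.<⇒≢ a<b (proj₁ (∷-injective e))

≺-head⁻¹ : {n : ℕ} {a b : Fin 3} (w : Word n) → (a ∷ w) ≺ (b ∷ w) → a <ᶠ b
≺-head⁻¹ w (p , ne) = FinP.≤∧≢⇒< (≼-head p) (λ e → ne (cong (_∷ w) e))

-- Covers in the language accepted from a phase s; for s = start this is Tr(n) and ⋖.
Cover : {n : ℕ} → Phase → Word n → Word n → Set
Cover {n} s u v = Accepted s u × Accepted s v × u ≺ v ×
  ((z : Word n) → Accepted s z → ¬ ((u ≺ z) × (z ≺ v)))

Cover-cons : {n : ℕ} (s : Phase) (a : Fin 3) {w w' : Word n} →
  T (allowed s a) → Cover (next s a) w w' → Cover s (a ∷ w) (a ∷ w')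
Cover-cons s a {w} {w'} ok (acc , acc' , w≺w' , minimal) =
  ∧-intro ok acc , ∧-intro ok acc' , ≺-cons a w≺w' , minimal'
  where
  minimal' : (z : Word _) → Accepted s z → ¬ (((a ∷ w) ≺ z) × (z ≺ (a ∷ w')))
  minimal' (c ∷ z) accZ (lower , upper) with FinP.≤-antisym (≼-head (proj₁ upper)) (≼-head (proj₁ lower))
  ... | refl = minimal z (accepted-tail s c z accZ) (≺-tail lower , ≺-tail upper)

Cover-tail : {n : ℕ} (s : Phase) (a : Fin 3) {w w' : Word n} →
  Cover s (a ∷ w) (a ∷ w') → Cover (next s a) w w'
Cover-tail s a {w} {w'} (acc , acc' , lt , minimal) =
  accepted-tail s a w acc , accepted-tail s a w' acc' , ≺-tail lt ,
  λ z accZ (l , l') → minimal (a ∷ z) (∧-intro (accepted-head s a w acc) accZ) (≺-cons a l , ≺-cons a l')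

-- A head step turns the first letter a into b in a single cover step with the tail w
-- fixed: 0→1 and 1→2 always, 0→2 exactly when the intermediate word 1∷w is rejected.
headStep : {n : ℕ} → Phase → Fin 3 → Fin 3 → Word n → Bool
headStep s f0 f1 w = true
headStep s f1 f2 w = true
headStep s f0 f2 w = not (accepts s (f1 ∷ w))
headStep s _  _  w = false

headStep-< : {n : ℕ} (s : Phase) {a b : Fin 3} (w : Word n) → T (headStep s a b w) → a <ᶠ b
headStep-< s {f0} {f1} w _ = z<s
headStep-< s {f0} {f2} w _ = z<s
headStep-< s {f1} {f2} w _ = s<s z<s

strictly-between : {a b c : Fin 3} → a <ᶠ c → c <ᶠ b → (a ≡ f0) × (c ≡ f1) × (b ≡ f2)
strictly-between {f0} {f2} {f1} _ _ = refl , refl , refl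
strictly-between {c = f0} () _
strictly-between {f1} {c = f1} (s≤s ()) _
strictly-between {f2} {c = f1} (s≤s ()) _
strictly-between {b = f0} {c = f1} _ ()
strictly-between {b = f1} {c = f1} _ (s≤s ())
strictly-between {b = f0} {c = f2} _ ()
strictly-between {b = f1} {c = f2} _ (s≤s ())
strictly-between {b = f2} {c = f2} _ (s≤s (s≤s ()))

headStep-nothing-between : {n : ℕ} (s : Phase) {a b c : Fin 3} (w : Word n) →
  T (headStep s a b w) → a <ᶠ c → c <ᶠ b → ¬ Accepted s (c ∷ w)
headStep-nothing-between s w step a<c c<b with strictly-between a<c c<b
... | refl , refl , refl with accepts s (f1 ∷ w)
...   | false = λ ()

headStep-complete : {n : ℕ} (s : Phase) {a b : Fin 3} (w : Word n) → a <ᶠ b →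
  ((c : Fin 3) → a <ᶠ c → c <ᶠ b → ¬ Accepted s (c ∷ w)) → T (headStep s a b w)
headStep-complete s {f0} {f1} w _ _ = tt
headStep-complete s {f1} {f2} w _ _ = tt
headStep-complete s {fs _} {f1} w (s≤s ()) _
headStep-complete s {f2} {f2} w (s≤s (s≤s ())) _
headStep-complete s {f0} {f2} w _ nothingBetween
  with accepts s (f1 ∷ w) | nothingBetween f1 z<s (s<s z<s)
... | true  | rejected = rejected tt
... | false | _        = tt

headCover : {n : ℕ} → Phase → Fin 3 → Fin 3 → Word n → Bool
headCover s a b w = headStep s a b w ∧ (accepts s (a ∷ w) ∧ accepts s (b ∷ w))

headCover-sound : {n : ℕ} (s : Phase) (a b : Fin 3) (w : Word n) →
  T (headCover s a b w) → Cover s (a ∷ w) (b ∷ w)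
headCover-sound s a b w h = acc , acc' , ≺-head w (headStep-< s w step) , minimal
  where
  step : T (headStep s a b w)
  step = proj₁ (∧-elim {headStep s a b w} h)
  accepted : Accepted s (a ∷ w) × Accepted s (b ∷ w)
  accepted = ∧-elim {accepts s (a ∷ w)} (proj₂ (∧-elim {headStep s a b w} h))
  acc : Accepted s (a ∷ w)
  acc = proj₁ accepted
  acc' : Accepted s (b ∷ w)
  acc' = proj₂ accepted
  minimal : (z : Word _) → Accepted s z → ¬ (((a ∷ w) ≺ z) × (z ≺ (b ∷ w)))
  minimal (c ∷ z) accZ (lower , upper) with ≼-antisym z w (≼-tail (proj₁ upper)) (≼-tail (proj₁ lower))
  ... | refl = headStep-nothing-between s w step (≺-head⁻¹ w lower) (≺-head⁻¹ w upper) accZ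

headCover-complete : {n : ℕ} (s : Phase) (a b : Fin 3) (w : Word n) →
  Cover s (a ∷ w) (b ∷ w) → T (headCover s a b w)
headCover-complete s a b w (acc , acc' , lt , minimal) =
  ∧-intro (headStep-complete s w (≺-head⁻¹ w lt) nothingBetween) (∧-intro acc acc')
  where
  nothingBetween : (c : Fin 3) → a <ᶠ c → c <ᶠ b → ¬ Accepted s (c ∷ w)
  nothingBetween c a<c c<b accC = minimal (c ∷ w) accC (≺-head w a<c , ≺-head w c<b)

_≟ʷ_ : {n : ℕ} (u v : Word n) → Dec (u ≡ v)
_≟ʷ_ = ≡-dec FinP._≟_

-- In a cover whose first letters differ, the tails agree: otherwise raising only the first
-- letter of the lower word gives an accepted word strictly in between.
Cover-sameTail : {n : ℕ} (s : Phase) {a b : Fin 3} {w w' : Word n} →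
  Cover s (a ∷ w) (b ∷ w') → a ≢ b → w ≡ w'
Cover-sameTail s {a} {b} {w} {w'} (acc , acc' , (le , _) , minimal) a≢b
  with w ≟ʷ w'
... | yes w≡w' = w≡w'
... | no  w≢w' = ⊥-elim (minimal (b ∷ w) accRaised (lower , upper))
  where
  accRaised : Accepted s (b ∷ w)
  accRaised = ∧-intro (accepted-head s b w' acc')
                      (next-mono s w (≼-head le) (accepted-tail s a w acc))
  lower : (a ∷ w) ≺ (b ∷ w)
  lower = ≺-head w (FinP.≤∧≢⇒< (≼-head le) a≢b)
  upper : (b ∷ w) ≺ (b ∷ w')
  upper = ≺-cons b (≼-tail le , w≢w')

cover : {n : ℕ} → Phase → Word n → Word n → Bool
cover s []      []       = false
cover s (a ∷ w) (b ∷ w') =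
  if does (a FinP.≟ b) then allowed s a ∧ cover (next s a) w w'
  else does (w ≟ʷ w') ∧ headCover s a b w

cover-sound : {n : ℕ} (s : Phase) (u v : Word n) → T (cover s u v) → Cover s u v
cover-sound s []      []       ()
cover-sound s (a ∷ w) (b ∷ w') h with a FinP.≟ b
... | yes refl = Cover-cons s a (proj₁ h') (cover-sound (next s a) w w' (proj₂ h'))
  where
  h' : T (allowed s a) × T (cover (next s a) w w')
  h' = ∧-elim {allowed s a} h
... | no _ with w ≟ʷ w'
...   | yes refl = headCover-sound s a b w h

cover-complete : {n : ℕ} (s : Phase) (u v : Word n) → Cover s u v → T (cover s u v)
cover-complete s [] [] (_ , _ , (_ , []≢[]) , _) = []≢[] refl
cover-complete s (a ∷ w) (b ∷ w') cov with a FinP.≟ b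
... | yes refl = ∧-intro (accepted-head s a w (proj₁ cov)) (cover-complete (next s a) w w' (Cover-tail s a cov))
... | no a≢b with w ≟ʷ w'
...   | yes refl = headCover-complete s a b w cov
...   | no  w≢w' = w≢w' (Cover-sameTail s cov a≢b)

count : {A : Set} → (A → Bool) → List A → ℕ
count p []       = 0
count p (x ∷ xs) = if p x then suc (count p xs) else count p xs

indicator : Bool → ℕ
indicator true  = 1
indicator false = 0

length-filter≡count : {A : Set} {P : A → Set} (P? : (x : A) → Dec (P x)) (p : A → Bool) →
  ((x : A) → P x ⇔ T (p x)) → (xs : List A) → length (filter P? xs) ≡ count p xs
length-filter≡count P? p equiv []       = refl
length-filter≡count P? p equiv (x ∷ xs)
  with P? x | p x | Equivalence.to (equiv x) | Equivalence.from (equiv x)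
... | yes _   | true  | _  | _    = cong suc (length-filter≡count P? p equiv xs)
... | yes px  | false | to | _    = ⊥-elim (to px)
... | no  ¬px | true  | _  | from = ⊥-elim (¬px (from tt))
... | no  _   | false | _  | _    = length-filter≡count P? p equiv xs

count-++ : {A : Set} (p : A → Bool) (xs ys : List A) → count p (xs ++ ys) ≡ count p xs + count p ys
count-++ p []       ys = refl
count-++ p (x ∷ xs) ys with p x
... | true  = cong suc (count-++ p xs ys)
... | false = count-++ p xs ys

count-map : {A B : Set} (p : B → Bool) (f : A → B) (xs : List A) →
  count p (map f xs) ≡ count (λ x → p (f x)) xs
count-map p f []       = refl
count-map p f (x ∷ xs) with p (f x)
... | true  = cong suc (count-map p f xs)
... | false = count-map p f xs

count-cong : {A : Set} {p q : A → Bool} → ((x : A) → p x ≡ q x) → (xs : List A) →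
  count p xs ≡ count q xs
count-cong p≡q []       = refl
count-cong {q = q} p≡q (x ∷ xs) rewrite p≡q x with q x
... | true  = cong suc (count-cong p≡q xs)
... | false = count-cong p≡q xs

count-none : {A : Set} (xs : List A) → count (λ _ → false) xs ≡ 0
count-none []       = refl
count-none (x ∷ xs) = count-none xs

count-allWords : {n : ℕ} (p : Word (suc n) → Bool) →
  count p (allWords (suc n)) ≡
    count (λ v → p (f0 ∷ v)) (allWords n) +
    (count (λ v → p (f1 ∷ v)) (allWords n) + count (λ v → p (f2 ∷ v)) (allWords n))
count-allWords {n} p = begin
  count p (map (f0 ∷_) ws ++ (map (f1 ∷_) ws ++ map (f2 ∷_) ws))
    ≡⟨ count-++ p (map (f0 ∷_) ws) _ ⟩
  count p (map (f0 ∷_) ws) + count p (map (f1 ∷_) ws ++ map (f2 ∷_) ws)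
    ≡⟨ cong (count p (map (f0 ∷_) ws) +_) (count-++ p (map (f1 ∷_) ws) _) ⟩
  count p (map (f0 ∷_) ws) + (count p (map (f1 ∷_) ws) + count p (map (f2 ∷_) ws))
    ≡⟨ cong₂ _+_ (count-map p (f0 ∷_) ws)
         (cong₂ _+_ (count-map p (f1 ∷_) ws) (count-map p (f2 ∷_) ws)) ⟩
  count (λ v → p (f0 ∷ v)) ws + (count (λ v → p (f1 ∷ v)) ws + count (λ v → p (f2 ∷ v)) ws) ∎
  where
  open ≡-Reasoning
  ws : List (Word n)
  ws = allWords n

-- Every word occurs exactly once in the enumeration, so a predicate forcing v = w
-- is counted once if it holds at w and not at all otherwise.
count-singleton : {n : ℕ} (k : Word n → Bool) (w : Word n) →
  count (λ v → does (v ≟ʷ w) ∧ k v) (allWords n) ≡ indicator (k w)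
count-singleton k [] with k []
... | true  = refl
... | false = refl
count-singleton {suc n} k (f0 ∷ w) = begin
  count (λ v → does (v ≟ʷ (f0 ∷ w)) ∧ k v) (allWords (suc n))
    ≡⟨ count-allWords (λ v → does (v ≟ʷ (f0 ∷ w)) ∧ k v) ⟩
  count (λ v → does (v ≟ʷ w) ∧ k (f0 ∷ v)) ws + (count (λ _ → false) ws + count (λ _ → false) ws)
    ≡⟨ cong₂ _+_ (count-singleton (λ v → k (f0 ∷ v)) w) (cong₂ _+_ (count-none ws) (count-none ws)) ⟩
  indicator (k (f0 ∷ w)) + 0
    ≡⟨ ℕP.+-identityʳ _ ⟩
  indicator (k (f0 ∷ w)) ∎
  where
  open ≡-Reasoning
  ws : List (Word n)
  ws = allWords n
count-singleton {suc n} k (f1 ∷ w) = begin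
  count (λ v → does (v ≟ʷ (f1 ∷ w)) ∧ k v) (allWords (suc n))
    ≡⟨ count-allWords (λ v → does (v ≟ʷ (f1 ∷ w)) ∧ k v) ⟩
  count (λ _ → false) ws + (count (λ v → does (v ≟ʷ w) ∧ k (f1 ∷ v)) ws + count (λ _ → false) ws)
    ≡⟨ cong₂ _+_ (count-none ws) (cong₂ _+_ (count-singleton (λ v → k (f1 ∷ v)) w) (count-none ws)) ⟩
  indicator (k (f1 ∷ w)) + 0
    ≡⟨ ℕP.+-identityʳ _ ⟩
  indicator (k (f1 ∷ w)) ∎
  where
  open ≡-Reasoning
  ws : List (Word n)
  ws = allWords n
count-singleton {suc n} k (f2 ∷ w) = trans (count-allWords (λ v → does (v ≟ʷ (f2 ∷ w)) ∧ k v)) $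
  cong₂ _+_ (count-none ws) (cong₂ _+_ (count-none ws) (count-singleton (λ v → k (f2 ∷ v)) w))
  where
  ws : List (Word n)
  ws = allWords n

degree : {n : ℕ} → Phase → Word n → ℕ
degree {n} s u = count (λ v → cover s v u) (allWords n) + count (λ v → cover s u v) (allWords n)

degreeVia : {n : ℕ} → Phase → Fin 3 → Word n → Fin 3 → ℕ
degreeVia {n} s a w c =
  count (λ v → cover s (c ∷ v) (a ∷ w)) (allWords n) + count (λ v → cover s (a ∷ w) (c ∷ v)) (allWords n)

headCoversVia : {n : ℕ} → Phase → Fin 3 → Word n → Fin 3 → ℕ
headCoversVia s a w c = indicator (headCover s c a w) + indicator (headCover s a c w)

headDegree : {n : ℕ} → Phase → Fin 3 → Word n → ℕ
headDegree s f0 w = headCoversVia s f0 w f1 + headCoversVia s f0 w f2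
headDegree s f1 w = headCoversVia s f1 w f0 + headCoversVia s f1 w f2
headDegree s f2 w = headCoversVia s f2 w f0 + headCoversVia s f2 w f1

degree-split : {n : ℕ} (s : Phase) (a : Fin 3) (w : Word n) →
  degree s (a ∷ w) ≡ degreeVia s a w f0 + degreeVia s a w f1 + degreeVia s a w f2
degree-split s a w = begin
  degree s (a ∷ w)
    ≡⟨ cong₂ _+_ (count-allWords (λ v → cover s v (a ∷ w))) (count-allWords (cover s (a ∷ w))) ⟩
  (x0 + (x1 + x2)) + (y0 + (y1 + y2))
    ≡⟨ interchange x0 x1 x2 y0 y1 y2 ⟩
  (x0 + y0) + (x1 + y1) + (x2 + y2) ∎
  where
  open ≡-Reasoning
  x0 x1 x2 y0 y1 y2 : ℕ
  x0 = count (λ v → cover s (f0 ∷ v) (a ∷ w)) (allWords _)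
  x1 = count (λ v → cover s (f1 ∷ v) (a ∷ w)) (allWords _)
  x2 = count (λ v → cover s (f2 ∷ v) (a ∷ w)) (allWords _)
  y0 = count (λ v → cover s (a ∷ w) (f0 ∷ v)) (allWords _)
  y1 = count (λ v → cover s (a ∷ w) (f1 ∷ v)) (allWords _)
  y2 = count (λ v → cover s (a ∷ w) (f2 ∷ v)) (allWords _)
  interchange : ∀ x0 x1 x2 y0 y1 y2 →
    (x0 + (x1 + x2)) + (y0 + (y1 + y2)) ≡ (x0 + y0) + (x1 + y1) + (x2 + y2)
  interchange = solve-∀

≟ʷ-sym : {n : ℕ} (u v : Word n) → does (u ≟ʷ v) ≡ does (v ≟ʷ u)
≟ʷ-sym u v with u ≟ʷ v | v ≟ʷ u
... | yes _   | yes _   = refl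
... | no  _   | no  _   = refl
... | yes u≡v | no  v≢u = ⊥-elim (v≢u (sym u≡v))
... | no  u≢v | yes v≡u = ⊥-elim (u≢v (sym v≡u))

cover-sameHead : {n : ℕ} (s : Phase) (a : Fin 3) → T (allowed s a) → (v w : Word n) →
  cover s (a ∷ v) (a ∷ w) ≡ cover (next s a) v w
cover-sameHead s a ok v w with a FinP.≟ a
... | no a≢a = ⊥-elim (a≢a refl)
... | yes refl with allowed s a | ok
...   | true | _ = refl

cover-otherHead : {n : ℕ} (s : Phase) {a b : Fin 3} → a ≢ b → (v w : Word n) →
  cover s (a ∷ v) (b ∷ w) ≡ does (v ≟ʷ w) ∧ headCover s a b v
cover-otherHead s {a} {b} a≢b v w with a FinP.≟ b
... | yes a≡b = ⊥-elim (a≢b a≡b)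
... | no  _   = refl

degreeVia-same : {n : ℕ} (s : Phase) (a : Fin 3) (w : Word n) → T (allowed s a) →
  degreeVia s a w a ≡ degree (next s a) w
degreeVia-same s a w ok = cong₂ _+_
  (count-cong (λ v → cover-sameHead s a ok v w) (allWords _))
  (count-cong (cover-sameHead s a ok w) (allWords _))

degreeVia-other : {n : ℕ} (s : Phase) (a c : Fin 3) (w : Word n) → a ≢ c →
  degreeVia s a w c ≡ headCoversVia s a w c
degreeVia-other s a c w a≢c = cong₂ _+_
  (trans (count-cong (λ v → cover-otherHead s (λ c≡a → a≢c (sym c≡a)) v w) (allWords _))
         (count-singleton (headCover s c a) w))
  (trans (count-cong upper (allWords _))
         (count-singleton (λ _ → headCover s a c w) w))
  where
  upper : (v : Word _) → cover s (a ∷ w) (c ∷ v) ≡ does (v ≟ʷ w) ∧ headCover s a c w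
  upper v = trans (cover-otherHead s a≢c w v) (cong (_∧ headCover s a c w) (≟ʷ-sym w v))

degree-step : {n : ℕ} (s : Phase) (a : Fin 3) (w : Word n) → T (allowed s a) →
  degree s (a ∷ w) ≡ headDegree s a w + degree (next s a) w
degree-step s f0 w ok = begin
  degree s (f0 ∷ w)
    ≡⟨ degree-split s f0 w ⟩
  degreeVia s f0 w f0 + degreeVia s f0 w f1 + degreeVia s f0 w f2
    ≡⟨ cong₂ _+_ (cong₂ _+_ (degreeVia-same s f0 w ok) (degreeVia-other s f0 f1 w (λ ())))
                 (degreeVia-other s f0 f2 w (λ ())) ⟩
  degree (next s f0) w + headCoversVia s f0 w f1 + headCoversVia s f0 w f2
    ≡⟨ rotate (degree (next s f0) w) (headCoversVia s f0 w f1) (headCoversVia s f0 w f2) ⟩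
  headDegree s f0 w + degree (next s f0) w ∎
  where
  open ≡-Reasoning
  rotate : ∀ x y z → x + y + z ≡ y + z + x
  rotate = solve-∀
degree-step s f1 w ok = begin
  degree s (f1 ∷ w)
    ≡⟨ degree-split s f1 w ⟩
  degreeVia s f1 w f0 + degreeVia s f1 w f1 + degreeVia s f1 w f2
    ≡⟨ cong₂ _+_ (cong₂ _+_ (degreeVia-other s f1 f0 w (λ ())) (degreeVia-same s f1 w ok))
                 (degreeVia-other s f1 f2 w (λ ())) ⟩
  headCoversVia s f1 w f0 + degree (next s f1) w + headCoversVia s f1 w f2
    ≡⟨ swap (headCoversVia s f1 w f0) (degree (next s f1) w) (headCoversVia s f1 w f2) ⟩
  headDegree s f1 w + degree (next s f1) w ∎
  where
  open ≡-Reasoning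
  swap : ∀ x y z → x + y + z ≡ x + z + y
  swap = solve-∀
degree-step s f2 w ok = begin
  degree s (f2 ∷ w)
    ≡⟨ degree-split s f2 w ⟩
  degreeVia s f2 w f0 + degreeVia s f2 w f1 + degreeVia s f2 w f2
    ≡⟨ cong₂ _+_ (cong₂ _+_ (degreeVia-other s f2 f0 w (λ ())) (degreeVia-other s f2 f1 w (λ ())))
                 (degreeVia-same s f2 w ok) ⟩
  headDegree s f2 w + degree (next s f2) w ∎
  where open ≡-Reasoning

-- The solution of the degree recursion: n from the phases `start` and `zeroSeen`, and
-- n + [u contains a 1] from `noZero` (a 1 is present exactly when u is rejected from
-- `zeroSeen`); the extra cover lowers the last 1 before the first 0 to a 0.
expectedDegree : {n : ℕ} → Phase → Word n → ℕ
expectedDegree {n} noZero u = indicator (not (accepts zeroSeen u)) + n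
expectedDegree {n} _      u = n

-- The head degree is exactly the increment of the expected degree.  Which head covers
-- exist depends only on whether w is accepted from `zeroSeen` and from `noZero`.
headDegree-increment : {n : ℕ} (s : Phase) (a : Fin 3) (w : Word n) → Accepted s (a ∷ w) →
  headDegree s a w + expectedDegree (next s a) w ≡ expectedDegree s (a ∷ w)
headDegree-increment start f0 w acc
  with accepts zeroSeen w | acc | accepts noZero w | zeroSeen⊆noZero w acc
... | true | _ | true | _ = refl
headDegree-increment start f1 w acc with accepts zeroSeen w | accepts noZero w | acc
... | true  | true | _ = refl
... | false | true | _ = refl
headDegree-increment start f2 w ()
headDegree-increment noZero f0 w acc
  with accepts zeroSeen w | acc | accepts noZero w | zeroSeen⊆noZero w acc
... | true | _ | true | _ = refl
headDegree-increment noZero f1 w acc with accepts zeroSeen w | accepts noZero w | acc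
... | true  | true | _ = refl
... | false | true | _ = refl
headDegree-increment noZero f2 w acc with accepts zeroSeen w | accepts noZero w | acc
... | true  | true | _ = refl
... | false | true | _ = refl
headDegree-increment zeroSeen f0 w acc with accepts zeroSeen w | acc
... | true | _ = refl
headDegree-increment zeroSeen f2 w acc with accepts zeroSeen w | acc
... | true | _ = refl

degree-formula : {n : ℕ} (s : Phase) (u : Word n) → Accepted s u → degree s u ≡ expectedDegree s u
degree-formula start    [] _ = refl
degree-formula noZero   [] _ = refl
degree-formula zeroSeen [] _ = refl
degree-formula s (a ∷ w) acc = begin
  degree s (a ∷ w)                                ≡⟨ degree-step s a w (accepted-head s a w acc) ⟩
  headDegree s a w + degree (next s a) w          ≡⟨ cong (headDegree s a w +_) tailFormula ⟩
  headDegree s a w + expectedDegree (next s a) w  ≡⟨ headDegree-increment s a w acc ⟩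
  expectedDegree s (a ∷ w)                        ∎
  where
  open ≡-Reasoning
  tailFormula : degree (next s a) w ≡ expectedDegree (next s a) w
  tailFormula = degree-formula (next s a) w (accepted-tail s a w acc)

⋖⇔cover : {n : ℕ} (u v : Word n) → u ⋖ v ⇔ T (cover start u v)
⋖⇔cover u v = mk⇔
  (λ (inU , inV , u≺v , minimal) → cover-complete start u v
     (start-complete u inU , start-complete v inV , u≺v ,
      λ z accZ → minimal z (start-sound z accZ)))
  (λ h → let (accU , accV , u≺v , minimal) = cover-sound start u v h in
     start-sound u accU , start-sound v accV , u≺v ,
     λ z inZ → minimal z (start-complete z inZ))

lemma3p4 : (n : ℕ) → n ≥ 1 → (u : Word n) → InTr u → inDeg u + outDeg u ≡ n
lemma3p4 n _ u inTr = begin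
  inDeg u + outDeg u
    ≡⟨ cong₂ _+_ (length-filter≡count (λ v → v ⋖? u) (λ v → cover start v u) (λ v → ⋖⇔cover v u) (allWords n))
                 (length-filter≡count (λ v → u ⋖? v) (cover start u) (⋖⇔cover u) (allWords n)) ⟩
  degree start u
    ≡⟨ degree-formula start u (start-complete u inTr) ⟩
  n ∎
  where open ≡-Reasoning
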